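{- A set $S$ of internal edges in a maximal outerplane graph $G$ is flippable if and only if the edges of the dual tree $G^*$ corresponding to $S$ form a matching in $G^*$.
   Context: A maximal outerplane graph is a plane graph with all vertices on the outer face and every internal face a triangle. An internal edge is one not on the outer face boundary. The dual tree $G^*$ has one vertex per internal face, two being adjacent when the faces share an (internal) edge; each internal edge thus corresponds to an edge of $G^*$. For an internal edge $vw$ with incident internal faces $(v,w,x)$ and $(w,v,y)$, flipping $vw$ replaces it by the edge $xy$ drawn inside the quadrilateral $vxwy$. For a set $S$ of internal edges, $\mathcal{F}(G,S)$ is obtained by flipping every edge of $S$; $S$ is flippable if $\mathcal{F}(G,S)$ is again a (simple) maximal outerplane graph. -}

module Defs where

open import Data.Nat using (ℕ; zero; suc; _<_; _≤_)
open import Data.Bool using (Bool; true; false)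
open import Data.Product using (_×_; _,_; Σ; ∃; ∃-syntax)
open import Data.Sum using (_⊎_)
open import Relation.Binary.PropositionalEquality using (_≡_)
open import Relation.Nullary using (¬_)

-- Model: a maximal outerplane graph on n ≥ 3 vertices is (up to plane
-- isomorphism) a triangulated convex n-gon with vertices 0,1,…,n-1 in
-- cyclic order along the outer face.  Edges are chords {i,j}, written
-- with i < j.

Chord : ℕ → ℕ → ℕ → Set
Chord n i j = (i < j) × (j < n)

Side : ℕ → ℕ → ℕ → Set
Side n i j = (suc i ≡ j) ⊎ ((i ≡ zero) × (suc j ≡ n))

Diagonal : ℕ → ℕ → ℕ → Set
Diagonal n i j = Chord n i j × ¬ Side n i j

Cross : ℕ → ℕ → ℕ → ℕ → Set
Cross i j k l = ((i < k) × (k < j) × (j < l)) ⊎ ((k < i) × (i < l) × (l < j))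

IsDiagonalSet : ℕ → (ℕ → ℕ → Set) → Set
IsDiagonalSet n E = ∀ i j → E i j → Diagonal n i j

-- E (together with the polygon sides) is a maximal outerplane graph:
-- its diagonals are pairwise non-crossing (plane), and every internal
-- face is a triangle (equivalently: no further diagonal can be added).
IsMOP : ℕ → (ℕ → ℕ → Set) → Set
IsMOP n E =
  IsDiagonalSet n E
  × (∀ i j k l → E i j → E k l → ¬ Cross i j k l)
  × (∀ i j → Diagonal n i j → ¬ E i j → ∃[ k ] ∃[ l ] (E k l × Cross i j k l))

⟦_⟧ : (ℕ → ℕ → Bool) → ℕ → ℕ → Set
⟦ D ⟧ i j = D i j ≡ true

Edge : ℕ → (ℕ → ℕ → Bool) → ℕ → ℕ → Set
Edge n D a b = Chord n a b × (Side n a b ⊎ D a b ≡ true)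

UEdge : ℕ → (ℕ → ℕ → Bool) → ℕ → ℕ → Set
UEdge n D a b = Edge n D a b ⊎ Edge n D b a

Face : ℕ → (ℕ → ℕ → Bool) → ℕ → ℕ → ℕ → Set
Face n D a b c = (a < b) × (b < c) × Edge n D a b × Edge n D b c × Edge n D a c

FaceHasEdge : ℕ → ℕ → ℕ → ℕ → ℕ → Set
FaceHasEdge a b c v w =
  ((v ≡ a) × (w ≡ b)) ⊎ ((v ≡ b) × (w ≡ c)) ⊎ ((v ≡ a) × (w ≡ c))

-- x is the third vertex of the face on the inner side of the edge (v,w)
InnerApex : ℕ → (ℕ → ℕ → Bool) → ℕ → ℕ → ℕ → Set
InnerApex n D v w x = (v < x) × (x < w) × Edge n D v x × Edge n D x w

-- y is the third vertex of the face on the outer side of the edge (v,w)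
OuterApex : ℕ → (ℕ → ℕ → Bool) → ℕ → ℕ → ℕ → Set
OuterApex n D v w y = ((y < v) ⊎ (w < y)) × UEdge n D y v × UEdge n D y w

FlipsTo : ℕ → (ℕ → ℕ → Bool) → ℕ → ℕ → ℕ → ℕ → Set
FlipsTo n D v w i j =
  Chord n i j ×
  ∃[ x ] ∃[ y ] (InnerApex n D v w x × OuterApex n D v w y
                 × (((i ≡ x) × (j ≡ y)) ⊎ ((i ≡ y) × (j ≡ x))))

FlipEdges : ℕ → (ℕ → ℕ → Bool) → (ℕ → ℕ → Bool) → ℕ → ℕ → Set
FlipEdges n D S i j =
  ((D i j ≡ true) × (S i j ≡ false))
  ⊎ (∃[ v ] ∃[ w ] ((S v w ≡ true) × FlipsTo n D v w i j))

-- F(G,S) has no multiple edges: distinct flipped edges produce distinct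
-- new edges, and no new edge coincides with a surviving edge
FlipSimple : ℕ → (ℕ → ℕ → Bool) → (ℕ → ℕ → Bool) → Set
FlipSimple n D S =
  (∀ v w v' w' i j → S v w ≡ true → S v' w' ≡ true →
     FlipsTo n D v w i j → FlipsTo n D v' w' i j → (v ≡ v') × (w ≡ w'))
  × (∀ v w i j → S v w ≡ true → FlipsTo n D v w i j →
       ¬ ((D i j ≡ true) × (S i j ≡ false)))

Flippable : ℕ → (ℕ → ℕ → Bool) → (ℕ → ℕ → Bool) → Set
Flippable n D S = FlipSimple n D S × IsMOP n (FlipEdges n D S)

-- the dual-tree edges corresponding to S form a matching of G*:
-- no two distinct edges of S correspond to dual edges sharing an endpoint,
-- i.e. no internal face is incident to two distinct edges of S
DualMatching : ℕ → (ℕ → ℕ → Bool) → (ℕ → ℕ → Bool) → Set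
DualMatching n D S =
  ∀ v w v' w' → S v w ≡ true → S v' w' ≡ true → ¬ ((v ≡ v') × (w ≡ w')) →
    ¬ (∃[ a ] ∃[ b ] ∃[ c ]
         (Face n D a b c × FaceHasEdge a b c v w × FaceHasEdge a b c v' w'))

{-# OPTIONS --safe #-}
module Submission where

-- Flipping an internal edge vw replaces it by the other diagonal of the quadrilateral formed by
-- the two faces at vw. A chord crossing one diagonal of a convex quadrilateral is either the other
-- diagonal or crosses one of its four sides, and these sides are exactly the edges sharing a face
-- with vw. So if no two edges of S share a face, the sides of every flipped quadrilateral survive,
-- and an old edge crossed by a new one must be the edge it replaced: F(G,S) is again plane and
-- maximal. Conversely, the flips of two edges of a common face always cross.

open import Data.Nat using (ℕ; suc; pred; _≤_; _<_; _∸_; z≤n; s≤s; _≟_; _<?_; _≤?_; NonZero; >-nonZero)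
open import Data.Nat.Properties
open import Data.Nat.Induction using (<-wellFounded)
open import Induction.WellFounded using (Acc; acc)
open import Data.Bool using (Bool; true; false)
import Data.Bool as Bool
open import Data.Bool.Properties using (not-¬; ¬-not)
open import Data.Product using (_×_; _,_; ∃; ∃-syntax; proj₁; proj₂)
open import Data.Sum using (_⊎_; inj₁; inj₂; map₂)
open import Data.Empty using (⊥; ⊥-elim)
open import Relation.Nullary using (¬_; Dec; yes; no; _×-dec_; _⊎-dec_)
open import Relation.Binary.PropositionalEquality using (_≡_; refl; sym; trans; cong)
open import Relation.Binary.Definitions using (tri<; tri≈; tri>)
open import Function.Bundles using (_⇔_; mk⇔)
open import Defs

private
  variable
    a b c i j k l p q r s v w v′ w′ x y : ℕ

m<n⇒n≮1+m : a < x → ¬ x < suc a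
m<n⇒n≮1+m a<x x<1+a = <⇒≱ a<x (≤-pred x<1+a)

pattern edge-ab = inj₁ (refl , refl)
pattern edge-bc = inj₂ (inj₁ (refl , refl))
pattern edge-ac = inj₂ (inj₂ (refl , refl))

Cross-sym : Cross i j k l → Cross k l i j
Cross-sym (inj₁ c) = inj₂ c
Cross-sym (inj₂ c) = inj₁ c

Side⇒¬Cross : ∀ {n} → Side n a b → j < n → ¬ Cross a b i j
Side⇒¬Cross (inj₁ refl)         _   (inj₁ (a<i , i<b , _)) = m<n⇒n≮1+m a<i i<b
Side⇒¬Cross (inj₁ refl)         _   (inj₂ (_ , a<j , j<b)) = m<n⇒n≮1+m a<j j<b
Side⇒¬Cross (inj₂ (refl , refl)) j<n (inj₁ (_ , _ , b<j))   = m<n⇒n≮1+m b<j j<n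
Side⇒¬Cross (inj₂ (refl , _))    _   (inj₂ (() , _ , _))

data QuadSide (p q r s : ℕ) : ℕ → ℕ → Set where
  pq : QuadSide p q r s p q
  qr : QuadSide p q r s q r
  rs : QuadSide p q r s r s
  ps : QuadSide p q r s p s

CrossesQuadSide : ℕ → ℕ → ℕ → ℕ → ℕ → ℕ → Set
CrossesQuadSide p q r s k l = ∃[ a ] ∃[ b ] (QuadSide p q r s a b × Cross a b k l)

crossing-qs-diagonal : p < q → q < r → r < s → Cross q s k l →
                       (k ≡ p × l ≡ r) ⊎ CrossesQuadSide p q r s k l
crossing-qs-diagonal {p} {q} {r} {s} {k} {l} p<q q<r r<s (inj₁ (q<k , k<s , s<l)) with <-cmp k r
... | tri< k<r _ _ = inj₂ (_ , _ , qr , inj₁ (q<k , k<r , <-trans r<s s<l))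
... | tri≈ _ refl _ = inj₂ (_ , _ , ps , inj₁ (<-trans p<q q<r , r<s , s<l))
... | tri> _ _ r<k = inj₂ (_ , _ , rs , inj₁ (r<k , k<s , s<l))
crossing-qs-diagonal {p} {q} {r} {s} {k} {l} p<q q<r r<s (inj₂ (k<q , q<l , l<s)) with <-cmp k p
... | tri< k<p _ _ = inj₂ (_ , _ , ps , inj₂ (k<p , <-trans p<q q<l , l<s))
... | tri> _ _ p<k = inj₂ (_ , _ , pq , inj₁ (p<k , k<q , q<l))
... | tri≈ _ refl _ with <-cmp l r
...   | tri< l<r _ _ = inj₂ (_ , _ , qr , inj₂ (p<q , q<l , l<r))
...   | tri≈ _ refl _ = inj₁ (refl , refl)
...   | tri> _ _ r<l = inj₂ (_ , _ , rs , inj₂ (<-trans p<q q<r , r<l , l<s))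

crossing-pr-diagonal : p < q → q < r → r < s → Cross p r k l →
                       (k ≡ q × l ≡ s) ⊎ CrossesQuadSide p q r s k l
crossing-pr-diagonal {p} {q} {r} {s} {k} {l} p<q q<r r<s (inj₁ (p<k , k<r , r<l)) with <-cmp k q
... | tri< k<q _ _ = inj₂ (_ , _ , pq , inj₁ (p<k , k<q , <-trans q<r r<l))
... | tri> _ _ q<k = inj₂ (_ , _ , qr , inj₁ (q<k , k<r , r<l))
... | tri≈ _ refl _ with <-cmp l s
...   | tri< l<s _ _ = inj₂ (_ , _ , rs , inj₂ (q<r , r<l , l<s))
...   | tri≈ _ refl _ = inj₁ (refl , refl)
...   | tri> _ _ s<l = inj₂ (_ , _ , ps , inj₁ (p<q , <-trans q<r r<s , s<l))
crossing-pr-diagonal {p} {q} {r} {s} {k} {l} p<q q<r r<s (inj₂ (k<p , p<l , l<r)) with <-cmp l q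
... | tri< l<q _ _ = inj₂ (_ , _ , pq , inj₂ (k<p , p<l , l<q))
... | tri≈ _ refl _ = inj₂ (_ , _ , ps , inj₂ (k<p , p<q , <-trans q<r r<s))
... | tri> _ _ q<l = inj₂ (_ , _ , qr , inj₂ (<-trans k<p p<q , q<l , l<r))

module Triangulation (n : ℕ) (D : ℕ → ℕ → Bool) (mop : IsMOP n ⟦ D ⟧) where

  private
    diagonals : IsDiagonalSet n ⟦ D ⟧
    diagonals = proj₁ mop

    noncrossing : ∀ i j k l → D i j ≡ true → D k l ≡ true → ¬ Cross i j k l
    noncrossing = proj₁ (proj₂ mop)

    maximal : ∀ i j → Diagonal n i j → ¬ D i j ≡ true → ∃[ k ] ∃[ l ] (D k l ≡ true × Cross i j k l)
    maximal = proj₂ (proj₂ mop)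

  diagonal-edge : D a b ≡ true → Edge n D a b
  diagonal-edge {a} {b} dab = proj₁ (diagonals a b dab) , inj₂ dab

  diagonal-gap : D a b ≡ true → suc a < b
  diagonal-gap {a} {b} dab with diagonals a b dab
  ... | (a<b , _) , not-side = ≤∧≢⇒< a<b (λ 1+a≡b → not-side (inj₁ 1+a≡b))

  edges-noncrossing : Edge n D a b → Edge n D i j → ¬ Cross a b i j
  edges-noncrossing (_ , inj₁ side) ((_ , j<n) , _) = Side⇒¬Cross side j<n
  edges-noncrossing ((_ , b<n) , inj₂ _) (_ , inj₁ side) c = Side⇒¬Cross side b<n (Cross-sym c)
  edges-noncrossing (_ , inj₂ dab) (_ , inj₂ dij) = noncrossing _ _ _ _ dab dij

  edge? : ∀ a b → Dec (Edge n D a b)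
  edge? a b = (a <? b ×-dec b <? n)
         ×-dec ((suc a ≟ b ⊎-dec (a ≟ 0 ×-dec suc b ≟ n)) ⊎-dec D a b Bool.≟ true)

  non-edge-crossed : Chord n a b → ¬ Edge n D a b → ∃[ k ] ∃[ l ] (D k l ≡ true × Cross a b k l)
  non-edge-crossed ch ¬ab = maximal _ _ (ch , λ side → ¬ab (ch , inj₁ side)) (λ dab → ¬ab (ch , inj₂ dab))

  UEdge-< : a < b → UEdge n D a b → Edge n D a b
  UEdge-< _   (inj₁ ab) = ab
  UEdge-< a<b (inj₂ ((b<a , _) , _)) = ⊥-elim (<-asym a<b b<a)

  UEdge-> : b < a → UEdge n D a b → Edge n D b a
  UEdge-> _   (inj₂ ba) = ba
  UEdge-> b<a (inj₁ ((a<b , _) , _)) = ⊥-elim (<-asym a<b b<a)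

  further-neighbour : Edge n D a c → a < x → x < c → Edge n D a x → ¬ Edge n D x c →
                      ∃[ l ] (x < l × l < c × Edge n D a l)
  further-neighbour {a = a} ac a<x x<c ax ¬xc with non-edge-crossed (x<c , proj₂ (proj₁ ac)) ¬xc
  ... | k , l , dkl , inj₁ (x<k , k<c , c<l) =
    ⊥-elim (edges-noncrossing ac (diagonal-edge dkl) (inj₁ (<-trans a<x x<k , k<c , c<l)))
  ... | k , l , dkl , inj₂ (k<x , x<l , l<c) with <-cmp k a
  ...   | tri< k<a _ _ = ⊥-elim (edges-noncrossing ac (diagonal-edge dkl) (inj₂ (k<a , <-trans a<x x<l , l<c)))
  ...   | tri≈ _ refl _ = l , x<l , l<c , diagonal-edge dkl
  ...   | tri> _ _ a<k = ⊥-elim (edges-noncrossing ax (diagonal-edge dkl) (inj₁ (a<k , k<x , x<l)))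

  inner-apex : Edge n D a c → suc a < c → ∃ (InnerApex n D a c)
  inner-apex {a = a} {c = c} ac 1+a<c =
    search (suc a) (n<1+n a) 1+a<c ((n<1+n a , <-trans 1+a<c (proj₂ (proj₁ ac))) , inj₁ (inj₁ refl))
           (<-wellFounded _)
    where
    search : ∀ x → a < x → x < c → Edge n D a x → Acc _<_ (c ∸ x) → ∃ (InnerApex n D a c)
    search x a<x x<c ax (acc smaller) with edge? x c
    ... | yes xc = x , a<x , x<c , ax , xc
    ... | no ¬xc with further-neighbour ac a<x x<c ax ¬xc
    ...   | l , x<l , l<c , al = search l (<-trans a<x x<l) l<c al (smaller (∸-monoʳ-< x<l (<⇒≤ l<c)))

  -- An apex strictly between v and w would make ab or bc cross vw.
  apex-outside : Edge n D a b → Edge n D b c → D v w ≡ true → a < v ⊎ w < c → w ≤ b ⊎ b ≤ v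
  apex-outside {b = b} {v = v} {w = w} ab bc dvw a<v⊎w<c with w ≤? b | b ≤? v
  ... | yes w≤b | _ = inj₁ w≤b
  ... | no _    | yes b≤v = inj₂ b≤v
  ... | no w≰b  | no b≰v with a<v⊎w<c
  ...   | inj₁ a<v =
    ⊥-elim (edges-noncrossing ab (diagonal-edge dvw) (inj₁ (a<v , ≰⇒> b≰v , ≰⇒> w≰b)))
  ...   | inj₂ w<c =
    ⊥-elim (edges-noncrossing bc (diagonal-edge dvw) (inj₂ (≰⇒> b≰v , ≰⇒> w≰b , w<c)))

  outer-apex : D v w ≡ true → ∃ (OuterApex n D v w)
  outer-apex {v = v} {w = w} dvw with diagonals v w dvw
  ... | (v<w , w<n) , not-side =
    descend 0 (pred n) boundary z≤n (<⇒≤pred w<n) strict (<-wellFounded _)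
    where
    instance
      n≢0 : NonZero n
      n≢0 = >-nonZero (≤-<-trans z≤n w<n)

    boundary : Edge n D 0 (pred n)
    boundary = (≤-<-trans z≤n (<-≤-trans v<w (<⇒≤pred w<n)) , ≤-reflexive (suc-pred n))
             , inj₁ (inj₂ (refl , suc-pred n))

    strict : 0 < v ⊎ w < pred n
    strict with m≤n⇒m<n∨m≡n (z≤n {v}) | m≤n⇒m<n∨m≡n (<⇒≤pred w<n)
    ... | inj₁ 0<v | _          = inj₁ 0<v
    ... | inj₂ _   | inj₁ w<n-1 = inj₂ w<n-1
    ... | inj₂ 0≡v | inj₂ w≡n-1 =
      ⊥-elim (not-side (inj₂ (sym 0≡v , trans (cong suc w≡n-1) (suc-pred n))))

    -- (a,c) runs through edges strictly enclosing vw, narrowing until vw is a side of the face below it.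
    descend : ∀ a c → Edge n D a c → a ≤ v → w ≤ c → a < v ⊎ w < c → Acc _<_ (c ∸ a) →
              ∃ (OuterApex n D v w)
    descend a c ac a≤v w≤c a<v⊎w<c (acc smaller)
      with inner-apex ac (≤-<-trans (s≤s a≤v) (<-≤-trans (diagonal-gap dvw) w≤c))
    ... | b , a<b , b<c , ab , bc with apex-outside ab bc dvw a<v⊎w<c
    ...   | inj₁ w≤b with m≤n⇒m<n∨m≡n a≤v | m≤n⇒m<n∨m≡n w≤b
    ...     | inj₂ refl | inj₂ refl = c , inj₂ b<c , inj₂ ac , inj₂ bc
    ...     | inj₁ a<v  | _         =
      descend a b ab a≤v w≤b (inj₁ a<v) (smaller (∸-monoˡ-< b<c (<⇒≤ a<b)))
    ...     | inj₂ _    | inj₁ w<b  =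
      descend a b ab a≤v w≤b (inj₂ w<b) (smaller (∸-monoˡ-< b<c (<⇒≤ a<b)))
    descend a c ac a≤v w≤c a<v⊎w<c (acc smaller)
        | b , a<b , b<c , ab , bc | inj₂ b≤v with m≤n⇒m<n∨m≡n b≤v | m≤n⇒m<n∨m≡n w≤c
    ...     | inj₂ refl | inj₂ refl = a , inj₁ a<b , inj₁ ab , inj₁ ac
    ...     | inj₁ b<v  | _         =
      descend b c bc b≤v w≤c (inj₁ b<v) (smaller (∸-monoʳ-< a<b (<⇒≤ b<c)))
    ...     | inj₂ _    | inj₁ w<c  =
      descend b c bc b≤v w≤c (inj₂ w<c) (smaller (∸-monoʳ-< a<b (<⇒≤ b<c)))

  diagonal-inner-apex : D a b ≡ true → ∃ (InnerApex n D a b)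
  diagonal-inner-apex dab = inner-apex (diagonal-edge dab) (diagonal-gap dab)

  flip-upward : InnerApex n D v w x → OuterApex n D v w y → w < y → FlipsTo n D v w x y
  flip-upward inner@(_ , x<w , _) outer@(_ , _ , yw) w<y =
    (<-trans x<w w<y , proj₂ (proj₁ (UEdge-> w<y yw))) , _ , _ , inner , outer , inj₁ (refl , refl)

  flip-downward : InnerApex n D v w x → OuterApex n D v w y → y < v → FlipsTo n D v w y x
  flip-downward inner@(v<x , x<w , _ , xw) outer y<v =
    (<-trans y<v v<x , <-trans x<w (proj₂ (proj₁ xw))) , _ , _ , inner , outer , inj₂ (refl , refl)

  flip-exists : D v w ≡ true → ∃[ i ] ∃[ j ] FlipsTo n D v w i j
  flip-exists dvw with diagonal-inner-apex dvw | outer-apex dvw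
  ... | _ , inner | _ , outer@(inj₁ y<v , _) = _ , _ , flip-downward inner outer y<v
  ... | _ , inner | _ , outer@(inj₂ w<y , _) = _ , _ , flip-upward inner outer w<y

  face-edge : Face n D a b c → FaceHasEdge a b c v w → Edge n D v w
  face-edge (_ , _ , ab , _  , _ ) edge-ab = ab
  face-edge (_ , _ , _  , bc , _ ) edge-bc = bc
  face-edge (_ , _ , _  , _  , ac) edge-ac = ac

  SharesFace : ℕ → ℕ → ℕ → ℕ → Set
  SharesFace v w a b = ∃[ x ] ∃[ y ] ∃[ z ] (Face n D x y z × FaceHasEdge x y z v w × FaceHasEdge x y z a b)

  DualAdjacent : ℕ → ℕ → ℕ → ℕ → Set
  DualAdjacent v w a b = ¬ (v ≡ a × w ≡ b) × SharesFace v w a b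

  DualAdjacent⇒Edge : DualAdjacent v w a b → Edge n D a b
  DualAdjacent⇒Edge (_ , _ , _ , _ , face , _ , has-ab) = face-edge face has-ab

  CrossesDualAdjacent : ℕ → ℕ → ℕ → ℕ → Set
  CrossesDualAdjacent v w k l = ∃[ a ] ∃[ b ] (DualAdjacent v w a b × Cross a b k l)

  record Quadrilateral (p q r s : ℕ) : Set where
    constructor quadrilateral
    field
      p<q  : p < q
      q<r  : q < r
      r<s  : r < s
      side : QuadSide p q r s a b → Edge n D a b

  open Quadrilateral

  pr-diagonal : Quadrilateral p q r s → Diagonal n p r
  pr-diagonal {s = s} Q = (<-trans (p<q Q) (q<r Q) , <-trans (r<s Q) s<n) , not-side
    where
    s<n : s < n
    s<n = proj₂ (proj₁ (side Q ps))
    not-side : ¬ Side n _ _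
    not-side (inj₁ refl)       = m<n⇒n≮1+m (p<q Q) (q<r Q)
    not-side (inj₂ (_ , refl)) = m<n⇒n≮1+m (r<s Q) s<n

  qs-diagonal : Quadrilateral p q r s → Diagonal n q s
  qs-diagonal Q = (<-trans (q<r Q) (r<s Q) , proj₂ (proj₁ (side Q ps))) , not-side
    where
    not-side : ¬ Side n _ _
    not-side (inj₁ refl)       = m<n⇒n≮1+m (q<r Q) (r<s Q)
    not-side (inj₂ (refl , _)) = ⊥-elim (<⇒≱ (p<q Q) z≤n)

  pr-faces : Quadrilateral p q r s → D p r ≡ true → Face n D p q r × Face n D p r s
  pr-faces Q dpr = (p<q Q , q<r Q , side Q pq , side Q qr , diagonal-edge dpr)
                 , (<-trans (p<q Q) (q<r Q) , r<s Q , diagonal-edge dpr , side Q rs , side Q ps)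

  qs-faces : Quadrilateral p q r s → D q s ≡ true → Face n D p q s × Face n D q r s
  qs-faces Q dqs = (p<q Q , <-trans (q<r Q) (r<s Q) , side Q pq , diagonal-edge dqs , side Q ps)
                 , (q<r Q , r<s Q , side Q qr , side Q rs , diagonal-edge dqs)

  pr-side-adjacent : Quadrilateral p q r s → D p r ≡ true → QuadSide p q r s a b → DualAdjacent p r a b
  pr-side-adjacent Q dpr pq = (λ (_ , r≡q) → <-irrefl (sym r≡q) (q<r Q))
                            , _ , _ , _ , proj₁ (pr-faces Q dpr) , edge-ac , edge-ab
  pr-side-adjacent Q dpr qr = (λ (p≡q , _) → <-irrefl p≡q (p<q Q))
                            , _ , _ , _ , proj₁ (pr-faces Q dpr) , edge-ac , edge-bc
  pr-side-adjacent Q dpr rs = (λ (_ , r≡s) → <-irrefl r≡s (r<s Q))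
                            , _ , _ , _ , proj₂ (pr-faces Q dpr) , edge-ab , edge-bc
  pr-side-adjacent Q dpr ps = (λ (_ , r≡s) → <-irrefl r≡s (r<s Q))
                            , _ , _ , _ , proj₂ (pr-faces Q dpr) , edge-ab , edge-ac

  qs-side-adjacent : Quadrilateral p q r s → D q s ≡ true → QuadSide p q r s a b → DualAdjacent q s a b
  qs-side-adjacent Q dqs pq = (λ (q≡p , _) → <-irrefl (sym q≡p) (p<q Q))
                            , _ , _ , _ , proj₁ (qs-faces Q dqs) , edge-bc , edge-ab
  qs-side-adjacent Q dqs qr = (λ (_ , s≡r) → <-irrefl (sym s≡r) (r<s Q))
                            , _ , _ , _ , proj₂ (qs-faces Q dqs) , edge-ac , edge-ab
  qs-side-adjacent Q dqs rs = (λ (q≡r , _) → <-irrefl q≡r (q<r Q))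
                            , _ , _ , _ , proj₂ (qs-faces Q dqs) , edge-ac , edge-bc
  qs-side-adjacent Q dqs ps = (λ (q≡p , _) → <-irrefl (sym q≡p) (p<q Q))
                            , _ , _ , _ , proj₁ (qs-faces Q dqs) , edge-bc , edge-ac

  via-sides : (∀ {a b} → QuadSide p q r s a b → DualAdjacent v w a b) →
              CrossesQuadSide p q r s k l → CrossesDualAdjacent v w k l
  via-sides adjacent (a , b , side , c) = a , b , adjacent side , c

  -- The two faces at vw form a quadrilateral p < q < r < s; vw is its diagonal pr when the
  -- outer apex lies above w, and its diagonal qs when the outer apex lies below v.
  data FlipQuad (v w i j : ℕ) : Set where
    upward   : Quadrilateral v i w j → FlipQuad v w i j
    downward : Quadrilateral i v j w → FlipQuad v w i j

  flipQuad : FlipsTo n D v w i j → FlipQuad v w i j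
  flipQuad (_ , _ , _ , (v<x , x<w , vx , xw) , (inj₂ w<y , yv , yw) , inj₁ (refl , refl)) =
    upward (quadrilateral v<x x<w w<y λ where
      pq → vx
      qr → xw
      rs → UEdge-> w<y yw
      ps → UEdge-> (<-trans (<-trans v<x x<w) w<y) yv)
  flipQuad (_ , _ , _ , (v<x , x<w , vx , xw) , (inj₁ y<v , yv , yw) , inj₂ (refl , refl)) =
    downward (quadrilateral y<v v<x x<w λ where
      pq → UEdge-< y<v yv
      qr → vx
      rs → xw
      ps → UEdge-< (<-trans y<v (<-trans v<x x<w)) yw)
  flipQuad ((y<x , _) , _ , _ , (_ , x<w , _) , (inj₂ w<y , _) , inj₂ (refl , refl)) =
    ⊥-elim (<-asym y<x (<-trans x<w w<y))
  flipQuad ((x<y , _) , _ , _ , (v<x , _) , (inj₁ y<v , _) , inj₁ (refl , refl)) =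
    ⊥-elim (<-asym x<y (<-trans y<v v<x))

  old-crosses-new : FlipQuad v w i j → Cross v w i j
  old-crosses-new (upward Q)   = inj₁ (p<q Q , q<r Q , r<s Q)
  old-crosses-new (downward Q) = inj₂ (p<q Q , q<r Q , r<s Q)

  new-is-diagonal : FlipQuad v w i j → Diagonal n i j
  new-is-diagonal (upward Q)   = qs-diagonal Q
  new-is-diagonal (downward Q) = pr-diagonal Q

  crossing-new : FlipQuad v w i j → D v w ≡ true → Cross i j k l →
                 (k ≡ v × l ≡ w) ⊎ CrossesDualAdjacent v w k l
  crossing-new (upward Q) dvw c =
    map₂ (via-sides (pr-side-adjacent Q dvw)) (crossing-qs-diagonal (p<q Q) (q<r Q) (r<s Q) c)
  crossing-new (downward Q) dvw c =
    map₂ (via-sides (qs-side-adjacent Q dvw)) (crossing-pr-diagonal (p<q Q) (q<r Q) (r<s Q) c)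

  crossing-old : FlipQuad v w i j → D v w ≡ true → Cross v w k l →
                 (k ≡ i × l ≡ j) ⊎ CrossesDualAdjacent v w k l
  crossing-old (upward Q) dvw c =
    map₂ (via-sides (pr-side-adjacent Q dvw)) (crossing-pr-diagonal (p<q Q) (q<r Q) (r<s Q) c)
  crossing-old (downward Q) dvw c =
    map₂ (via-sides (qs-side-adjacent Q dvw)) (crossing-qs-diagonal (p<q Q) (q<r Q) (r<s Q) c)

  edge-crossing-new : FlipQuad v w i j → D v w ≡ true → Edge n D a b → Cross i j a b → a ≡ v × b ≡ w
  edge-crossing-new F dvw ab c with crossing-new F dvw c
  ... | inj₁ replaced = replaced
  ... | inj₂ (_ , _ , adjacent , c′) = ⊥-elim (edges-noncrossing (DualAdjacent⇒Edge adjacent) ab c′)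

  face-outer-ab : Face n D a b c → OuterApex n D a b c
  face-outer-ab (_ , b<c , _ , bc , ac) = inj₂ b<c , inj₂ ac , inj₂ bc

  face-outer-bc : Face n D a b c → OuterApex n D b c a
  face-outer-bc (a<b , _ , ab , _ , ac) = inj₁ a<b , inj₁ ab , inj₁ ac

  face-inner-ac : Face n D a b c → InnerApex n D a c b
  face-inner-ac (a<b , b<c , ab , bc , _) = a<b , b<c , ab , bc

  FlipsCross : ℕ → ℕ → ℕ → ℕ → Set
  FlipsCross v w v′ w′ =
    ∃[ i ] ∃[ j ] ∃[ k ] ∃[ l ] (FlipsTo n D v w i j × FlipsTo n D v′ w′ k l × Cross i j k l)

  FlipsCross-sym : FlipsCross v w v′ w′ → FlipsCross v′ w′ v w
  FlipsCross-sym (_ , _ , _ , _ , f , f′ , c) = _ , _ , _ , _ , f′ , f , Cross-sym c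

  flips-cross-ab-bc : Face n D a b c → D a b ≡ true → D b c ≡ true → FlipsCross a b b c
  flips-cross-ab-bc face@(a<b , b<c , _) dab dbc with diagonal-inner-apex dab | diagonal-inner-apex dbc
  ... | _ , inner@(a<x , x<b , _) | _ , inner′@(b<x′ , x′<c , _) =
    _ , _ , _ , _ , flip-upward inner (face-outer-ab face) b<c
                  , flip-downward inner′ (face-outer-bc face) a<b
                  , inj₂ (a<x , <-trans x<b b<x′ , x′<c)

  flips-cross-ab-ac : Face n D a b c → D a b ≡ true → D a c ≡ true → FlipsCross a b a c
  flips-cross-ab-ac face@(_ , b<c , _) dab dac with diagonal-inner-apex dab | outer-apex dac
  ... | _ , inner@(a<x , x<b , _) | _ , outer@(inj₁ y<a , _) =
    _ , _ , _ , _ , flip-upward inner (face-outer-ab face) b<c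
                  , flip-downward (face-inner-ac face) outer y<a
                  , inj₂ (<-trans y<a a<x , x<b , b<c)
  ... | _ , inner@(_ , x<b , _) | _ , outer@(inj₂ c<y , _) =
    _ , _ , _ , _ , flip-upward inner (face-outer-ab face) b<c
                  , flip-upward (face-inner-ac face) outer c<y
                  , inj₁ (x<b , b<c , c<y)

  flips-cross-bc-ac : Face n D a b c → D b c ≡ true → D a c ≡ true → FlipsCross b c a c
  flips-cross-bc-ac face@(a<b , _) dbc dac with diagonal-inner-apex dbc | outer-apex dac
  ... | _ , inner@(b<x , _) | _ , outer@(inj₁ y<a , _) =
    _ , _ , _ , _ , flip-downward inner (face-outer-bc face) a<b
                  , flip-downward (face-inner-ac face) outer y<a
                  , inj₂ (y<a , a<b , b<x)
  ... | _ , inner@(b<x , x<c , _) | _ , outer@(inj₂ c<y , _) =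
    _ , _ , _ , _ , flip-downward inner (face-outer-bc face) a<b
                  , flip-upward (face-inner-ac face) outer c<y
                  , inj₁ (a<b , b<x , <-trans x<c c<y)

  face-flips-cross : Face n D a b c → FaceHasEdge a b c v w → FaceHasEdge a b c v′ w′ →
                     D v w ≡ true → D v′ w′ ≡ true → ¬ (v ≡ v′ × w ≡ w′) → FlipsCross v w v′ w′
  face-flips-cross F edge-ab edge-ab _ _  distinct = ⊥-elim (distinct (refl , refl))
  face-flips-cross F edge-ab edge-bc d d′ _        = flips-cross-ab-bc F d d′
  face-flips-cross F edge-ab edge-ac d d′ _        = flips-cross-ab-ac F d d′
  face-flips-cross F edge-bc edge-ab d d′ _        = FlipsCross-sym (flips-cross-ab-bc F d′ d)
  face-flips-cross F edge-bc edge-bc _ _  distinct = ⊥-elim (distinct (refl , refl))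
  face-flips-cross F edge-bc edge-ac d d′ _        = flips-cross-bc-ac F d d′
  face-flips-cross F edge-ac edge-ab d d′ _        = FlipsCross-sym (flips-cross-ab-ac F d′ d)
  face-flips-cross F edge-ac edge-bc d d′ _        = FlipsCross-sym (flips-cross-bc-ac F d′ d)
  face-flips-cross F edge-ac edge-ac _ _  distinct = ⊥-elim (distinct (refl , refl))

  module _ (S : ℕ → ℕ → Bool) (S⊆D : ∀ i j → S i j ≡ true → D i j ≡ true) where

    private
      S⇒D : S i j ≡ true → D i j ≡ true
      S⇒D = S⊆D _ _

    flipped : S v w ≡ true → FlipsTo n D v w i j → FlipEdges n D S i j
    flipped s f = inj₂ (_ , _ , s , f)

    CrossesFlipEdge : ℕ → ℕ → Set
    CrossesFlipEdge i j = ∃[ k ] ∃[ l ] (FlipEdges n D S k l × Cross i j k l)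

    flips-injective : ∀ v w v′ w′ i j → S v w ≡ true → S v′ w′ ≡ true →
                      FlipsTo n D v w i j → FlipsTo n D v′ w′ i j → v ≡ v′ × w ≡ w′
    flips-injective _ _ _ _ _ _ s s′ f f′
      with edge-crossing-new (flipQuad f) (S⇒D s) (diagonal-edge (S⇒D s′))
                             (Cross-sym (old-crosses-new (flipQuad f′)))
    ... | refl , refl = refl , refl

    flipped-not-kept : ∀ v w i j → S v w ≡ true → FlipsTo n D v w i j → ¬ (D i j ≡ true × S i j ≡ false)
    flipped-not-kept v w i j s f (dij , _) = noncrossing v w i j (S⇒D s) dij (old-crosses-new (flipQuad f))

    flipEdges-diagonal : IsDiagonalSet n (FlipEdges n D S)
    flipEdges-diagonal i j (inj₁ (dij , _))       = diagonals i j dij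
    flipEdges-diagonal i j (inj₂ (_ , _ , _ , f)) = new-is-diagonal (flipQuad f)

    kept-avoids-flipped : D a b ≡ true → S a b ≡ false → S v w ≡ true → FlipsTo n D v w i j →
                          ¬ Cross i j a b
    kept-avoids-flipped dab sab s f c with edge-crossing-new (flipQuad f) (S⇒D s) (diagonal-edge dab) c
    ... | refl , refl = not-¬ s sab

    module _ (matching : DualMatching n D S) where

      dual-adjacent-not-flipped : S v w ≡ true → DualAdjacent v w a b → S a b ≡ false
      dual-adjacent-not-flipped {a = a} {b = b} s (distinct , shared) with S a b in sab
      ... | false = refl
      ... | true  = ⊥-elim (matching _ _ _ _ s sab distinct shared)

      flipped-noncrossing : S v w ≡ true → FlipsTo n D v w i j → S v′ w′ ≡ true → FlipsTo n D v′ w′ k l →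
                            ¬ Cross i j k l
      flipped-noncrossing s f s′ f′ c with crossing-new (flipQuad f) (S⇒D s) c
      ... | inj₁ (refl , refl) = noncrossing _ _ _ _ (S⇒D s′) (S⇒D s) (old-crosses-new (flipQuad f′))
      ... | inj₂ (_ , _ , adjacent , c′)
          with edge-crossing-new (flipQuad f′) (S⇒D s′) (DualAdjacent⇒Edge adjacent) (Cross-sym c′)
      ...   | refl , refl = not-¬ s′ (dual-adjacent-not-flipped s adjacent)

      flipEdges-noncrossing : ∀ i j k l → FlipEdges n D S i j → FlipEdges n D S k l → ¬ Cross i j k l
      flipEdges-noncrossing i j k l (inj₁ (dij , _)) (inj₁ (dkl , _)) = noncrossing i j k l dij dkl
      flipEdges-noncrossing _ _ _ _ (inj₁ (dij , sij)) (inj₂ (_ , _ , s , f)) c =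
        kept-avoids-flipped dij sij s f (Cross-sym c)
      flipEdges-noncrossing _ _ _ _ (inj₂ (_ , _ , s , f)) (inj₁ (dkl , skl)) =
        kept-avoids-flipped dkl skl s f
      flipEdges-noncrossing _ _ _ _ (inj₂ (_ , _ , s , f)) (inj₂ (_ , _ , s′ , f′)) =
        flipped-noncrossing s f s′ f′

      edge-crossing⇒CrossesFlipEdge : Diagonal n i j → ¬ FlipEdges n D S i j → D k l ≡ true → Cross i j k l →
                                      CrossesFlipEdge i j
      edge-crossing⇒CrossesFlipEdge {k = k} {l = l} ((_ , j<n) , _) ∉F dkl c with S k l in skl
      ... | false = k , l , inj₁ (dkl , skl) , c
      ... | true with flip-exists dkl
      ...   | _ , _ , f with crossing-old (flipQuad f) dkl (Cross-sym c)
      ...     | inj₁ (refl , refl) = ⊥-elim (∉F (flipped skl f))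
      ...     | inj₂ (a , b , adjacent , cab) with DualAdjacent⇒Edge adjacent
      ...       | _ , inj₁ side = ⊥-elim (Side⇒¬Cross side j<n cab)
      ...       | _ , inj₂ dab  = a , b , inj₁ (dab , dual-adjacent-not-flipped skl adjacent) , Cross-sym cab

      flipEdges-maximal : ∀ i j → Diagonal n i j → ¬ FlipEdges n D S i j → CrossesFlipEdge i j
      flipEdges-maximal i j dg ∉F with D i j Bool.≟ true
      ... | no ¬dij = let (_ , _ , dkl , c) = maximal i j dg ¬dij in edge-crossing⇒CrossesFlipEdge dg ∉F dkl c
      ... | yes dij with S i j Bool.≟ true
      ...   | no ¬sij = ⊥-elim (∉F (inj₁ (dij , ¬-not ¬sij)))
      ...   | yes sij = let (k , l , f) = flip-exists dij in k , l , flipped sij f , old-crosses-new (flipQuad f)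

    matching⇒flippable : DualMatching n D S → Flippable n D S
    matching⇒flippable matching =
      (flips-injective , flipped-not-kept)
      , flipEdges-diagonal , flipEdges-noncrossing matching , flipEdges-maximal matching

    flippable⇒matching : Flippable n D S → DualMatching n D S
    flippable⇒matching (_ , _ , noncrossingF , _) _ _ _ _ s s′ distinct (_ , _ , _ , face , has , has′)
      with face-flips-cross face has has′ (S⇒D s) (S⇒D s′) distinct
    ... | i , j , k , l , f , f′ , c = noncrossingF i j k l (flipped s f) (flipped s′ f′) c

mainTheorem13 : (n : ℕ) → 3 ≤ n → (D S : ℕ → ℕ → Bool) →
    IsMOP n ⟦ D ⟧ →
    (∀ i j → S i j ≡ true → D i j ≡ true) →
    Flippable n D S ⇔ DualMatching n D S
mainTheorem13 n _ D S mop S⊆D = mk⇔ (flippable⇒matching S S⊆D) (matching⇒flippable S S⊆D)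
  where open Triangulation n D mop
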